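{- Let $\mathcal{F}$ be a $k$-regular biset-family on a finite set $T$, and let $\hat X,\hat Y\in\mathcal{F}^k$ intersect. Then $\hat X\cap\hat Y\in\mathcal{F}^k$ and $\hat X\cup\hat Y\in\mathcal{F}$.
   Context: A biset on $T$ is an ordered pair $\hat X=(X,X^+)$ with $X\subseteq X^+\subseteq T$; $\Gamma(\hat X)=X^+\setminus X$. $\hat X\cap\hat Y=(X\cap Y,X^+\cap Y^+)$, $\hat X\cup\hat Y=(X\cup Y,X^+\cup Y^+)$; $\hat X,\hat Y$ intersect if $X\cap Y\neq\emptyset$. A biset-family $\mathcal{F}$ on $T$ is $k$-regular if $|\Gamma(\hat X)|\le k$ for all $\hat X\in\mathcal{F}$ and $\hat X\cap\hat Y,\hat X\cup\hat Y\in\mathcal{F}$ for all intersecting $\hat X,\hat Y\in\mathcal{F}$ with $|X\cup Y|\le|T|-k-1$. $\mathcal{F}^k=\{\hat X\in\mathcal{F}:|X|\le(|T|-k)/2\}$. -}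

module Defs where

open import Data.Nat using (ℕ; suc; _+_; _*_; _≤_)
open import Data.Fin.Subset using (Subset; _⊆_; _∩_; _∪_; _─_; ∣_∣; Nonempty)
open import Data.Product using (_×_; _,_; proj₁; proj₂)
open import Level using (Level; suc) renaming (_⊔_ to _⊔ℓ_)

-- The ground set T is Fin n (a finite set with |T| = n).
Pair : ℕ → Set
Pair n = Subset n × Subset n

inner : ∀ {n} → Pair n → Subset n
inner = proj₁

outer : ∀ {n} → Pair n → Subset n
outer = proj₂

IsBiset : ∀ {n} → Pair n → Set
IsBiset (X , X⁺) = X ⊆ X⁺

Γ : ∀ {n} → Pair n → Subset n
Γ (X , X⁺) = X⁺ ─ X

_∩̂_ : ∀ {n} → Pair n → Pair n → Pair n
(X , X⁺) ∩̂ (Y , Y⁺) = (X ∩ Y , X⁺ ∩ Y⁺)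

_∪̂_ : ∀ {n} → Pair n → Pair n → Pair n
(X , X⁺) ∪̂ (Y , Y⁺) = (X ∪ Y , X⁺ ∪ Y⁺)

Intersect : ∀ {n} → Pair n → Pair n → Set
Intersect X̂ Ŷ = Nonempty (inner X̂ ∩ inner Ŷ)

IsBisetFamily : ∀ {n} {ℓ : Level} → (Pair n → Set ℓ) → Set ℓ
IsBisetFamily {n} F = ∀ (X̂ : Pair n) → F X̂ → IsBiset X̂

-- k-regular: |Γ(X̂)| ≤ k for all members, and closure under ∩ and ∪ for
-- intersecting members with |X ∪ Y| ≤ |T| - k - 1 (written |X ∪ Y| + k + 1 ≤ n).
record IsRegular {n} {ℓ : Level} (k : ℕ) (F : Pair n → Set ℓ) : Set ℓ where
  field
    Γ-bound : ∀ (X̂ : Pair n) → F X̂ → ∣ Γ X̂ ∣ ≤ k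
    ∩-closed : ∀ (X̂ Ŷ : Pair n) → F X̂ → F Ŷ → Intersect X̂ Ŷ →
               ∣ inner X̂ ∪ inner Ŷ ∣ + k + 1 ≤ n → F (X̂ ∩̂ Ŷ)
    ∪-closed : ∀ (X̂ Ŷ : Pair n) → F X̂ → F Ŷ → Intersect X̂ Ŷ →
               ∣ inner X̂ ∪ inner Ŷ ∣ + k + 1 ≤ n → F (X̂ ∪̂ Ŷ)

-- F^k = { X̂ ∈ F : |X| ≤ (|T| - k)/2 }, written 2·|X| + k ≤ n (exact over ℕ).
_^[_] : ∀ {n : ℕ} {ℓ : Level} → (Pair n → Set ℓ) → ℕ → (Pair n → Set ℓ)
_^[_] {n} F k X̂ = F X̂ × (2 * ∣ inner X̂ ∣ + k ≤ n)

module Submission where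

-- Everything reduces to two counting facts about the inner sets X, Y.
--  * Since X ∩ Y ≠ ∅, inclusion–exclusion |X ∪ Y| + |X ∩ Y| = |X| + |Y|
--    gives the strict bound |X ∪ Y| < |X| + |Y|.
--  * Averaging the two Fᵏ-bounds 2|X| + k ≤ n and 2|Y| + k ≤ n gives
--    |X| + |Y| + k ≤ n.
-- Together, |X ∪ Y| + k + 1 ≤ n, which is exactly the size condition under
-- which k-regularity provides X̂ ∩ Ŷ, X̂ ∪ Ŷ ∈ F.  Finally X ∩ Y ⊆ X, so the
-- Fᵏ-bound of X̂ transfers to X̂ ∩ Ŷ.  Only the inner sets matter.

open import Defs
open import Data.Nat using (ℕ; suc; _+_; _*_; _≤_; _<_; s≤s; z≤n)
open import Data.Nat.Properties
  using (≤-trans; +-suc; +-comm; +-mono-≤; +-monoˡ-≤; +-monoʳ-≤; *-monoʳ-≤; *-cancelˡ-≤)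
open import Data.Nat.Tactic.RingSolver using (solve-∀)
open import Data.Product using (_×_; _,_)
open import Level using (Level)
open import Data.Bool using (true; false)
open import Data.Vec using ([]; _∷_)
open import Data.Fin.Subset using (Subset; _∩_; _∪_; ∣_∣; Nonempty)
open import Data.Fin.Subset.Properties using (∣p∩q∣≤∣p∣; x∈p⇒∣p-x∣<∣p∣)
open import Relation.Binary.PropositionalEquality
  using (_≡_; refl; sym; trans; cong; subst; subst₂; module ≡-Reasoning)

∣p∪q∣+∣p∩q∣≡∣p∣+∣q∣ : ∀ {n} (p q : Subset n) → ∣ p ∪ q ∣ + ∣ p ∩ q ∣ ≡ ∣ p ∣ + ∣ q ∣
∣p∪q∣+∣p∩q∣≡∣p∣+∣q∣ []          []          = refl
∣p∪q∣+∣p∩q∣≡∣p∣+∣q∣ (false ∷ p) (false ∷ q) = ∣p∪q∣+∣p∩q∣≡∣p∣+∣q∣ p q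
∣p∪q∣+∣p∩q∣≡∣p∣+∣q∣ (true ∷ p)  (false ∷ q) = cong suc (∣p∪q∣+∣p∩q∣≡∣p∣+∣q∣ p q)
∣p∪q∣+∣p∩q∣≡∣p∣+∣q∣ (false ∷ p) (true ∷ q)  =
  trans (cong suc (∣p∪q∣+∣p∩q∣≡∣p∣+∣q∣ p q)) (sym (+-suc ∣ p ∣ ∣ q ∣))
∣p∪q∣+∣p∩q∣≡∣p∣+∣q∣ (true ∷ p)  (true ∷ q)  = cong suc (begin
  ∣ p ∪ q ∣ + suc ∣ p ∩ q ∣    ≡⟨ +-suc ∣ p ∪ q ∣ ∣ p ∩ q ∣ ⟩
  suc (∣ p ∪ q ∣ + ∣ p ∩ q ∣)  ≡⟨ cong suc (∣p∪q∣+∣p∩q∣≡∣p∣+∣q∣ p q) ⟩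
  suc (∣ p ∣ + ∣ q ∣)          ≡⟨ +-suc ∣ p ∣ ∣ q ∣ ⟨
  ∣ p ∣ + suc ∣ q ∣            ∎)
  where open ≡-Reasoning

nonempty⇒0<∣p∣ : ∀ {n} {p : Subset n} → Nonempty p → 0 < ∣ p ∣
nonempty⇒0<∣p∣ (x , x∈p) = ≤-trans (s≤s z≤n) (x∈p⇒∣p-x∣<∣p∣ x∈p)

-- Union is strictly subadditive on intersecting sets: the common element is
-- counted twice in |p| + |q| but once in |p ∪ q|.
∣p∪q∣<∣p∣+∣q∣ : ∀ {n} (p q : Subset n) → Nonempty (p ∩ q) → ∣ p ∪ q ∣ < ∣ p ∣ + ∣ q ∣
∣p∪q∣<∣p∣+∣q∣ p q p∩q≠∅ =
  subst (∣ p ∪ q ∣ <_) (∣p∪q∣+∣p∩q∣≡∣p∣+∣q∣ p q)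
        (subst (_≤ ∣ p ∪ q ∣ + ∣ p ∩ q ∣) (+-comm ∣ p ∪ q ∣ 1)
               (+-monoʳ-≤ ∣ p ∪ q ∣ (nonempty⇒0<∣p∣ p∩q≠∅)))

sum-of-bounds : ∀ a b k → 2 * a + k + (2 * b + k) ≡ 2 * (a + b + k)
sum-of-bounds = solve-∀

+-double : ∀ n → n + n ≡ 2 * n
+-double = solve-∀

suc-to-end : ∀ u k → suc u + k ≡ u + k + 1
suc-to-end = solve-∀

-- Averaging: if a and b both satisfy the Fᵏ-type bound 2x + k ≤ n, then
-- a + b + k ≤ n (add the two bounds and halve).
average-bound : ∀ a b {k n} → 2 * a + k ≤ n → 2 * b + k ≤ n → a + b + k ≤ n
average-bound a b {k} {n} ha hb =
  *-cancelˡ-≤ 2 (subst₂ _≤_ (sum-of-bounds a b k) (+-double n) (+-mono-≤ ha hb))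

small-intersecting-union : ∀ {n k} (X Y : Subset n) → Nonempty (X ∩ Y) →
  2 * ∣ X ∣ + k ≤ n → 2 * ∣ Y ∣ + k ≤ n → ∣ X ∪ Y ∣ + k + 1 ≤ n
small-intersecting-union {n} {k} X Y X∩Y≠∅ hX hY =
  subst (_≤ n) (suc-to-end ∣ X ∪ Y ∣ k)
        (≤-trans (+-monoˡ-≤ k (∣p∪q∣<∣p∣+∣q∣ X Y X∩Y≠∅)) (average-bound ∣ X ∣ ∣ Y ∣ hX hY))

lemma2p4 : ∀ {ℓ : Level} (n k : ℕ) (F : Pair n → Set ℓ) →
    IsBisetFamily F → IsRegular k F →
    ∀ (X̂ Ŷ : Pair n) → (F ^[ k ]) X̂ → (F ^[ k ]) Ŷ → Intersect X̂ Ŷ →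
    (F ^[ k ]) (X̂ ∩̂ Ŷ) × F (X̂ ∪̂ Ŷ)
lemma2p4 n k F _ regular X̂@(X , _) Ŷ@(Y , _) (X∈F , X-small) (Y∈F , Y-small) X∩Y≠∅ =
  (X∩Y∈F , X∩Y-small) , X∪Y∈F
  where
  open IsRegular regular using (∩-closed; ∪-closed)

  size-ok : ∣ X ∪ Y ∣ + k + 1 ≤ n
  size-ok = small-intersecting-union X Y X∩Y≠∅ X-small Y-small

  X∩Y∈F : F (X̂ ∩̂ Ŷ)
  X∩Y∈F = ∩-closed X̂ Ŷ X∈F Y∈F X∩Y≠∅ size-ok

  X∪Y∈F : F (X̂ ∪̂ Ŷ)
  X∪Y∈F = ∪-closed X̂ Ŷ X∈F Y∈F X∩Y≠∅ size-ok

  X∩Y-small : 2 * ∣ X ∩ Y ∣ + k ≤ n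
  X∩Y-small = ≤-trans (+-monoˡ-≤ k (*-monoʳ-≤ 2 (∣p∩q∣≤∣p∣ X Y))) X-small
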